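{- For every even $n\ge 2$ there is a game in $L(n,2^{n/2},1/n)$ with no pure $1/8$-equilibrium.
   Context: An $n$-player game $G$ in normal form is given by finite strategy sets $A_1,\dots,A_n$ and payoff functions $f_i:A\to\mathbb{R}$, where $A=\prod_{i=1}^n A_i$; write $a=(a_i,a_{ -i})$ with $a_{ -i}\in A_{ -i}=\prod_{j\ne i}A_j$. On $A_{ -i}$ use the metric $\rho(a'_{ -i},a''_{ -i})=\#\{j\ne i: a'_j\ne a''_j\}$. The Lipschitz constant of $G$ is $\delta(G)=\max|f_i(a_i,a'_{ -i})-f_i(a_i,a''_{ -i})|$ over all players $i$, all $a_i\in A_i$ and all $a'_{ -i},a''_{ -i}$ with $\rho(a'_{ -i},a''_{ -i})=1$. $L(n,m,\delta)$ is the set of games with $n$ players, at most $m$ strategies for every player, and Lipschitz constant at most $\delta$. A pure $\epsilon$-equilibrium is a profile $a\in A$ with $f_i(d,a_{ -i})\le f_i(a)+\epsilon$ for all players $i$ and all $d\in A_i$. -}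

module Defs where

open import Data.Nat as ℕ using (ℕ; zero; suc; _≤_)
open import Data.Fin using (Fin; _≟_)
open import Data.Integer using (+_)
open import Data.Rational using (ℚ; 0ℚ; ∣_∣; _-_; _+_) renaming (_≤_ to _≤ℚ_; _/_ to _÷_)
open import Data.Product using (Σ; _×_)
open import Relation.Nullary using (¬_; yes; no)
open import Relation.Binary.PropositionalEquality using (_≡_; _≢_; refl)

record Game (n : ℕ) : Set where
  field
    size   : Fin n → ℕ
    payoff : Fin n → ((i : Fin n) → Fin (size i)) → ℚ

module _ {n : ℕ} (G : Game n) where
  open Game G

  Profile : Set
  Profile = (i : Fin n) → Fin (size i)

  deviate : Profile → (i : Fin n) → Fin (size i) → Profile
  deviate a i d k with k ≟ i
  ... | yes refl = d
  ... | no _     = a k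

  -- a and b agree on player i and ρ(a_{-i}, b_{-i}) = 1
  Neighbours : Fin n → Profile → Profile → Set
  Neighbours i a b =
    a i ≡ b i × Σ (Fin n) (λ j → j ≢ i × a j ≢ b j × ((k : Fin n) → k ≢ j → a k ≡ b k))

  LipschitzLe : ℚ → Set
  LipschitzLe δ = (i : Fin n) (a b : Profile) → Neighbours i a b →
    ∣ payoff i a - payoff i b ∣ ≤ℚ δ

  StrategiesAtMost : ℕ → Set
  StrategiesAtMost m = (i : Fin n) → 1 ≤ size i × size i ≤ m

  IsPureEquilibrium : ℚ → Profile → Set
  IsPureEquilibrium ε a = (i : Fin n) (d : Fin (size i)) →
    payoff i (deviate a i d) ≤ℚ payoff i a + ε

InL : (n m : ℕ) → ℚ → Game n → Set
InL n m δ G = StrategiesAtMost G m × LipschitzLe G δ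

-- 1/n (only used for n ≥ 2; value at 0 is irrelevant)
recip : ℕ → ℚ
recip zero    = 0ℚ
recip (suc k) = + 1 ÷ suc k

module Submission where

-- For n = 2k players we build a game of "matching pennies" type.  Players
-- split into k matchers p and k mismatchers r; every player owns the
-- strategy set {0,1}^k (of size 2^k).  Mismatcher r only uses the r-th
-- bit b_r of its strategy; matcher p with strategy X_p earns
-- #{r : X_p(r) = b_r}/n and mismatcher r earns #{p : X_p(r) ≠ b_r}/n.
--
--  * Lipschitz: a payoff is a count divided by n whose terms each depend
--    on a different opponent, so a single opponent changes it by ≤ 1/n.
--  * No pure 1/8-equilibrium: a matcher can copy all bits and earn k/n = 1/2,
--    a mismatcher can flip its bit.  The 1/8-equilibrium inequalities give
--    6k ≤ 8·(matches of p) and 6k ≤ 16·(mismatches of r); summing over all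
--    players and using matches + mismatches = k² yields 18k² ≤ 16k².

open import Defs
open import Data.Nat as ℕ using (ℕ; zero; suc; z≤n; s≤s; _≤_; _+_; _*_; _^_)
import Data.Nat.Properties as ℕP
open import Data.Nat.Tactic.RingSolver using (solve-∀)
open import Data.Nat.DivMod using (_/_; m*n/n≡m)
open import Data.Nat.Divisibility using (_∣_; divides)
open import Data.Integer as ℤ using (+_)
import Data.Integer.Properties as ℤP
open import Data.Rational as ℚ using (ℚ; ∣_∣; _-_; -_; toℚᵘ)
  renaming (_≤_ to _≤ℚ_; _+_ to _+ℚ_; _/_ to _÷_)
import Data.Rational.Properties as ℚP
open import Data.Rational.Solver using (module +-*-Solver)
open import Data.Rational.Unnormalised as ℚᵘ using (mkℚᵘ; *≤*) renaming (_≃_ to _≃ᵘ_)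
import Data.Rational.Unnormalised.Properties as ℚᵘP
open import Data.Fin using (Fin; zero; suc; _≟_; _↑ˡ_; _↑ʳ_; splitAt; finToFun; funToFin)
import Data.Fin.Properties as FinP
open import Algebra.Properties.Semiring.Sum ℕP.+-*-semiring
  using (sum; sum-cong-≗; ∑-distrib-+; ∑-comm; *-distribˡ-sum)
open import Function using (_∘_)
open import Data.Sum using (_⊎_; inj₁; inj₂)
open import Data.Product using (Σ; _×_; _,_)
open import Data.Empty using (⊥; ⊥-elim)
open import Relation.Nullary using (¬_; yes; no)
open import Relation.Nullary.Decidable using (decidable-stable)
open import Relation.Binary.PropositionalEquality

open +-*-Solver using (solve; _:+_; _:-_; :-_; _:=_)

≤+⇒-≤ : ∀ {x y z : ℚ} → x ≤ℚ y +ℚ z → x - y ≤ℚ z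
≤+⇒-≤ {x} {y} {z} x≤y+z = ℚP.≤-trans (ℚP.+-monoˡ-≤ (- y) x≤y+z)
  (ℚP.≤-reflexive (solve 2 (λ y z → (y :+ z) :- y := z) refl y z))

∣-∣≤ : ∀ {x y z : ℚ} → x ≤ℚ y +ℚ z → y ≤ℚ x +ℚ z → ∣ x - y ∣ ≤ℚ z
∣-∣≤ {x} {y} {z} x≤y+z y≤x+z with ℚP.∣p∣≡p∨∣p∣≡-p (x - y)
... | inj₁ ∣d∣≡d  = subst (_≤ℚ z) (sym ∣d∣≡d) (≤+⇒-≤ x≤y+z)
... | inj₂ ∣d∣≡-d = subst (_≤ℚ z) (sym (trans ∣d∣≡-d -[x-y]≡y-x)) (≤+⇒-≤ y≤x+z)
  where
  -[x-y]≡y-x : - (x - y) ≡ y - x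
  -[x-y]≡y-x = solve 2 (λ x y → :- (x :- y) := y :- x) refl x y

toℚᵘ-÷ : ∀ a m → toℚᵘ (+ a ÷ suc m) ≃ᵘ mkℚᵘ (+ a) m
toℚᵘ-÷ a m = ℚP.toℚᵘ-fromℚᵘ (mkℚᵘ (+ a) m)

÷-mono : ∀ {a b m d} → a * suc d ≤ b * suc m → + a ÷ suc m ≤ℚ + b ÷ suc d
÷-mono {a} {b} {m} {d} h = ℚP.toℚᵘ-cancel-≤
  (ℚᵘP.≤-respˡ-≃ (ℚᵘP.≃-sym (toℚᵘ-÷ a m)) (ℚᵘP.≤-respʳ-≃ (ℚᵘP.≃-sym (toℚᵘ-÷ b d))
    (*≤* (subst₂ ℤ._≤_ (ℤP.pos-* a (suc d)) (ℤP.pos-* b (suc m)) (ℤ.+≤+ h)))))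

÷-cancel : ∀ {a b m d} → + a ÷ suc m ≤ℚ + b ÷ suc d → a * suc d ≤ b * suc m
÷-cancel {a} {b} {m} {d} h
  with ℚᵘP.≤-respʳ-≃ (toℚᵘ-÷ b d) (ℚᵘP.≤-respˡ-≃ (toℚᵘ-÷ a m) (ℚP.toℚᵘ-mono-≤ h))
... | *≤* h′ = ℤP.drop‿+≤+
  (subst₂ ℤ._≤_ (sym (ℤP.pos-* a (suc d))) (sym (ℤP.pos-* b (suc m))) h′)

÷-+ : ∀ a b m d → + a ÷ suc m +ℚ + b ÷ suc d ≡ + (a * suc d + b * suc m) ÷ (suc m * suc d)
÷-+ a b m d = ℚP.toℚᵘ-injective (begin
  toℚᵘ (+ a ÷ suc m +ℚ + b ÷ suc d)          ≈⟨ ℚP.toℚᵘ-homo-+ (+ a ÷ suc m) (+ b ÷ suc d) ⟩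
  toℚᵘ (+ a ÷ suc m) ℚᵘ.+ toℚᵘ (+ b ÷ suc d)  ≈⟨ ℚᵘP.+-cong (toℚᵘ-÷ a m) (toℚᵘ-÷ b d) ⟩
  mkℚᵘ (+ a) m ℚᵘ.+ mkℚᵘ (+ b) d             ≡⟨ cong (λ i → mkℚᵘ i _) numerator ⟨
  mkℚᵘ (+ (a * suc d + b * suc m)) _          ≈⟨ toℚᵘ-÷ _ _ ⟨
  toℚᵘ (+ (a * suc d + b * suc m) ÷ (suc m * suc d)) ∎)
  where
  open ℚᵘP.≃-Reasoning
  numerator : + (a * suc d + b * suc m) ≡ + a ℤ.* + suc d ℤ.+ + b ℤ.* + suc m
  numerator = trans (ℤP.pos-+ (a * suc d) (b * suc m))
    (cong₂ ℤ._+_ (ℤP.pos-* a (suc d)) (ℤP.pos-* b (suc m)))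

÷-lipschitz : ∀ {a b} m → a ≤ suc b → b ≤ suc a →
  ∣ + a ÷ suc m - + b ÷ suc m ∣ ≤ℚ + 1 ÷ suc m
÷-lipschitz m a≤1+b b≤1+a = ∣-∣≤ (≤+1/n a≤1+b) (≤+1/n b≤1+a)
  where
  ≤+1/n : ∀ {a b} → a ≤ suc b → + a ÷ suc m ≤ℚ + b ÷ suc m +ℚ + 1 ÷ suc m
  ≤+1/n {a} {b} a≤1+b = subst (_ ≤ℚ_) (sym (÷-+ b 1 m m))
    (÷-mono {a} {b * suc m + 1 * suc m} {m} {m + m * suc m} (begin
      a * (suc m * suc m)               ≤⟨ ℕP.*-monoˡ-≤ (suc m * suc m) a≤1+b ⟩
      suc b * (suc m * suc m)           ≡⟨ expand b (suc m) ⟩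
      (b * suc m + 1 * suc m) * suc m   ∎))
    where
    open ℕP.≤-Reasoning
    expand : ∀ b n → suc b * (n * n) ≡ (b * n + 1 * n) * n
    expand = solve-∀

÷-ε-bound : ∀ {a b} m → + a ÷ suc m ≤ℚ + b ÷ suc m +ℚ + 1 ÷ 8 → 8 * a ≤ 8 * b + suc m
÷-ε-bound {a} {b} m h = ℕP.*-cancelʳ-≤ (8 * a) (8 * b + suc m) (suc m)
  (subst₂ _≤_ (lhs a (suc m)) (rhs b (suc m))
    (÷-cancel {a} {b * 8 + 1 * suc m} {m} {7 + m * 8} (subst (_ ≤ℚ_) (÷-+ b 1 m 7) h)))
  where
  lhs : ∀ a n → a * (n * 8) ≡ 8 * a * n
  lhs = solve-∀
  rhs : ∀ b n → (b * 8 + 1 * n) * n ≡ (8 * b + n) * n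
  rhs = solve-∀

sum-const : ∀ k c → sum {k} (λ _ → c) ≡ k * c
sum-const zero    c = refl
sum-const (suc k) c = cong (λ s → c + s) (sum-const k c)

sum-mono : ∀ {k} {f g : Fin k → ℕ} → (∀ x → f x ≤ g x) → sum f ≤ sum g
sum-mono {zero}  f≤g = z≤n
sum-mono {suc k} f≤g = ℕP.+-mono-≤ (f≤g zero) (sum-mono (f≤g ∘ suc))

sum-bound : ∀ {k} c d (f : Fin k → ℕ) → (∀ x → c ≤ d * f x) → k * c ≤ d * sum f
sum-bound {k} c d f c≤df = begin
  k * c               ≡⟨ sum-const k c ⟨
  sum {k} (λ _ → c)   ≤⟨ sum-mono c≤df ⟩
  sum (λ x → d * f x) ≡⟨ *-distribˡ-sum d f ⟨
  d * sum f           ∎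
  where open ℕP.≤-Reasoning

AtMostOneDifference : ∀ {k} → (Fin k → ℕ) → (Fin k → ℕ) → Set
AtMostOneDifference f g = ∀ x y → f x ≢ g x → f y ≢ g y → x ≡ y

sum-one-difference : ∀ {k} {f g : Fin k → ℕ} → (∀ x → f x ≤ 1) →
  AtMostOneDifference f g → sum f ≤ suc (sum g)
sum-one-difference {zero}  f≤1 once = z≤n
sum-one-difference {suc k} {f} {g} f≤1 once with f zero ℕ.≟ g zero
... | yes f₀≡g₀ = begin
  f zero + sum (f ∘ suc)        ≤⟨ ℕP.+-mono-≤ (ℕP.≤-reflexive f₀≡g₀) tail≤ ⟩
  g zero + suc (sum (g ∘ suc))  ≡⟨ ℕP.+-suc (g zero) _ ⟩
  suc (g zero + sum (g ∘ suc))  ∎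
  where
  open ℕP.≤-Reasoning
  tail≤ : sum (f ∘ suc) ≤ suc (sum (g ∘ suc))
  tail≤ = sum-one-difference (f≤1 ∘ suc)
    (λ x y fx≢gx fy≢gy → FinP.suc-injective (once (suc x) (suc y) fx≢gx fy≢gy))
... | no f₀≢g₀ = begin
  f zero + sum (f ∘ suc)        ≤⟨ ℕP.+-monoˡ-≤ _ (f≤1 zero) ⟩
  suc (sum (f ∘ suc))           ≡⟨ cong suc (sum-cong-≗ tail≡) ⟩
  suc (sum (g ∘ suc))           ≤⟨ s≤s (ℕP.m≤n+m _ (g zero)) ⟩
  suc (g zero + sum (g ∘ suc))  ∎
  where
  open ℕP.≤-Reasoning
  -- all other terms agree, since the only difference is at position zero
  tail≡ : ∀ x → f (suc x) ≡ g (suc x)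
  tail≡ x = decidable-stable (f (suc x) ℕ.≟ g (suc x))
    (λ fx≢gx → FinP.0≢1+n (once zero (suc x) f₀≢g₀ fx≢gx))

module _ {n : ℕ} (G : Game n) where

  deviate-self : ∀ (a : Profile G) i d → deviate G a i d i ≡ d
  deviate-self a i d with i ≟ i
  ... | yes refl = refl
  ... | no i≢i   = ⊥-elim (i≢i refl)

  deviate-other : ∀ (a : Profile G) i d {j} → j ≢ i → deviate G a i d j ≡ a j
  deviate-other a i d {j} j≢i with j ≟ i
  ... | yes j≡i = ⊥-elim (j≢i j≡i)
  ... | no _    = refl

  neighbours-differ-once : ∀ {i a b l l′} → Neighbours G i a b →
    a l ≢ b l → a l′ ≢ b l′ → l ≡ l′
  neighbours-differ-once {a = a} {b} (_ , j , _ , _ , agree) al≢bl al′≢bl′ =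
    trans (is-j al≢bl) (sym (is-j al′≢bl′))
    where
    is-j : ∀ {l} → a l ≢ b l → l ≡ j
    is-j {l} al≢bl with l ≟ j
    ... | yes l≡j = l≡j
    ... | no l≢j  = ⊥-elim (al≢bl (agree l l≢j))

  local-terms-differ-once : ∀ {i a b k} (e : Fin k → Fin n) (f g : Fin k → ℕ) →
    (∀ x y → e x ≡ e y → x ≡ y) → Neighbours G i a b →
    (∀ x → a (e x) ≡ b (e x) → f x ≡ g x) → AtMostOneDifference f g
  local-terms-differ-once e f g e-inj nb local x y fx≢gx fy≢gy =
    e-inj x y (neighbours-differ-once nb (fx≢gx ∘ local x) (fy≢gy ∘ local y))

-- K cells are split into C agreements and M disagreements; the bounds
-- 6K ≤ 8C and 6K ≤ 16M would force 18K ≤ 16K, so K = 0.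
no-room : ∀ {K C M} → 6 * K ≤ 8 * C → 6 * K ≤ 16 * M → C + M ≡ K → K ≡ 0
no-room {zero}  _ _ _ = refl
no-room {suc K} {C} {M} 6K≤8C 6K≤16M C+M≡K =
  ⊥-elim (18≰16 (ℕP.*-cancelʳ-≤ 18 16 (suc K) (begin
  18 * suc K                     ≡⟨ split (suc K) ⟩
  2 * (6 * suc K) + 6 * suc K    ≤⟨ ℕP.+-mono-≤ (ℕP.*-monoʳ-≤ 2 6K≤8C) 6K≤16M ⟩
  2 * (8 * C) + 16 * M           ≡⟨ merge C M ⟩
  16 * (C + M)                   ≡⟨ cong (16 *_) C+M≡K ⟩
  16 * suc K                     ∎)))
  where
  open ℕP.≤-Reasoning
  split : ∀ K → 18 * K ≡ 2 * (6 * K) + 6 * K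
  split = solve-∀
  merge : ∀ C M → 2 * (8 * C) + 16 * M ≡ 16 * (C + M)
  merge = solve-∀
  18≰16 : ¬ (18 ≤ 16)
  18≰16 = ℕP.<⇒≱ (s≤s (ℕP.n≤1+n 16))

agree : Fin 2 → Fin 2 → ℕ
agree zero       zero       = 1
agree zero       (suc zero) = 0
agree (suc zero) zero       = 0
agree (suc zero) (suc zero) = 1

flip : Fin 2 → Fin 2
flip zero       = suc zero
flip (suc zero) = zero

disagree : Fin 2 → Fin 2 → ℕ
disagree x y = agree x (flip y)

agree≤1 : ∀ x y → agree x y ≤ 1
agree≤1 zero       zero       = s≤s z≤n
agree≤1 zero       (suc zero) = z≤n
agree≤1 (suc zero) zero       = z≤n
agree≤1 (suc zero) (suc zero) = s≤s z≤n

agree-refl : ∀ x → agree x x ≡ 1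
agree-refl zero       = refl
agree-refl (suc zero) = refl

flip-involutive : ∀ x → flip (flip x) ≡ x
flip-involutive zero       = refl
flip-involutive (suc zero) = refl

agree+disagree : ∀ x y → agree x y + disagree x y ≡ 1
agree+disagree zero       zero       = refl
agree+disagree zero       (suc zero) = refl
agree+disagree (suc zero) zero       = refl
agree+disagree (suc zero) (suc zero) = refl

-- n = 2k players, written k + k in the game and k * 2 in the statement.
k+k≡k*2 : ∀ k → k + k ≡ k * 2
k+k≡k*2 = solve-∀

module MatchingPennies (k′ : ℕ) where

  k : ℕ
  k = suc k′

  -- A strategy is an element of {0,1}^k, encoded in Fin (2 ^ k).
  StrategyProfile : Set
  StrategyProfile = Fin (k + k) → Fin (2 ^ k)

  bits : Fin (2 ^ k) → Fin k → Fin 2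
  bits = finToFun

  matcher mismatcher : Fin k → Fin (k + k)
  matcher p    = p ↑ˡ k
  mismatcher r = k ↑ʳ r

  matcher≢mismatcher : ∀ p r → matcher p ≢ mismatcher r
  matcher≢mismatcher p r eq with
    trans (sym (FinP.splitAt-↑ˡ k p k)) (trans (cong (splitAt k) eq) (FinP.splitAt-↑ʳ k k r))
  ... | ()

  match mismatch : StrategyProfile → Fin k → Fin k → ℕ
  match    a p r = agree    (bits (a (matcher p)) r) (bits (a (mismatcher r)) r)
  mismatch a p r = disagree (bits (a (matcher p)) r) (bits (a (mismatcher r)) r)

  -- Matches of matcher p, mismatches against mismatcher r, and matches
  -- against mismatcher r (which r can obtain by flipping its bit).
  matches mismatches columnMatches : StrategyProfile → Fin k → ℕ
  matches       a p = sum (match a p)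
  mismatches    a r = sum (λ p → mismatch a p r)
  columnMatches a r = sum (λ p → match a p r)

  -- Every one of the k matchers either matches or mismatches bit r.
  column-total : ∀ a r → columnMatches a r + mismatches a r ≡ k
  column-total a r = begin
    columnMatches a r + mismatches a r        ≡⟨ ∑-distrib-+ (λ p → match a p r) (λ p → mismatch a p r) ⟨
    sum (λ p → match a p r + mismatch a p r)  ≡⟨ sum-cong-≗ cell-total ⟩
    sum {k} (λ _ → 1)                         ≡⟨ sum-const k 1 ⟩
    k * 1                                     ≡⟨ ℕP.*-identityʳ k ⟩
    k                                         ∎
    where
    open ≡-Reasoning
    cell-total : ∀ p → match a p r + mismatch a p r ≡ 1
    cell-total p = agree+disagree (bits (a (matcher p)) r) (bits (a (mismatcher r)) r)

  share : ℕ → ℚ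
  share c = + c ÷ (k + k)

  payoffBySide : Fin k ⊎ Fin k → StrategyProfile → ℚ
  payoffBySide (inj₁ p) a = share (matches a p)
  payoffBySide (inj₂ r) a = share (mismatches a r)

  game : Game (k + k)
  game = record { size = λ _ → 2 ^ k ; payoff = λ i → payoffBySide (splitAt k i) }

  payoff-matcher : ∀ a p → Game.payoff game (matcher p) a ≡ share (matches a p)
  payoff-matcher a p = cong (λ side → payoffBySide side a) (FinP.splitAt-↑ˡ k p k)

  payoff-mismatcher : ∀ a r → Game.payoff game (mismatcher r) a ≡ share (mismatches a r)
  payoff-mismatcher a r = cong (λ side → payoffBySide side a) (FinP.splitAt-↑ʳ k k r)

  count-lipschitz : (f g : Fin k → ℕ) → (∀ x → f x ≤ 1) → (∀ x → g x ≤ 1) →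
    AtMostOneDifference f g → ∣ share (sum f) - share (sum g) ∣ ≤ℚ share 1
  count-lipschitz f g f≤1 g≤1 once = ÷-lipschitz (k′ + k)
    (sum-one-difference f≤1 once)
    (sum-one-difference g≤1 (λ x y gx≢fx gy≢fy → once x y (≢-sym gx≢fx) (≢-sym gy≢fy)))

  -- Each term of a player's count depends on one opponent only.
  lipschitz : LipschitzLe game (recip (k + k))
  lipschitz i a b nb@(ai≡bi , _) with splitAt k i in split≡
  ... | inj₁ p = count-lipschitz (match a p) (match b p) (λ _ → agree≤1 _ _) (λ _ → agree≤1 _ _)
    (local-terms-differ-once game mismatcher (match a p) (match b p)
      (FinP.↑ʳ-injective k) nb local)
    where
    own : a (matcher p) ≡ b (matcher p)
    own = subst (λ j → a j ≡ b j) (sym (FinP.splitAt⁻¹-↑ˡ split≡)) ai≡bi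
    local : ∀ x → a (mismatcher x) ≡ b (mismatcher x) → match a p x ≡ match b p x
    local x same = cong₂ agree (cong (λ s → bits s x) own) (cong (λ s → bits s x) same)
  ... | inj₂ r = count-lipschitz (λ p → mismatch a p r) (λ p → mismatch b p r)
    (λ _ → agree≤1 _ _) (λ _ → agree≤1 _ _)
    (local-terms-differ-once game matcher (λ p → mismatch a p r) (λ p → mismatch b p r)
      (FinP.↑ˡ-injective k) nb local)
    where
    own : a (mismatcher r) ≡ b (mismatcher r)
    own = subst (λ j → a j ≡ b j) (sym (FinP.splitAt⁻¹-↑ʳ split≡)) ai≡bi
    local : ∀ x → a (matcher x) ≡ b (matcher x) → mismatch a x r ≡ mismatch b x r
    local x same = cong₂ disagree (cong (λ s → bits s r) same) (cong (λ s → bits s r) own)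

  -- Matcher p can copy every mismatcher's bit and thereby match all k of them.
  copy-bits : StrategyProfile → Fin (2 ^ k)
  copy-bits a = funToFin {k} {2} (λ r → bits (a (mismatcher r)) r)

  matches-copy-bits : ∀ a p → matches (deviate game a (matcher p) (copy-bits a)) p ≡ k
  matches-copy-bits a p = begin
    sum (match a′ p)     ≡⟨ sum-cong-≗ copied ⟩
    sum {k} (λ _ → 1)    ≡⟨ sum-const k 1 ⟩
    k * 1                ≡⟨ ℕP.*-identityʳ k ⟩
    k                    ∎
    where
    open ≡-Reasoning
    a′ : StrategyProfile
    a′ = deviate game a (matcher p) (copy-bits a)
    copied : ∀ r → match a′ p r ≡ 1
    copied r = trans (cong₂ agree
      (trans (cong (λ s → bits s r) (deviate-self game a (matcher p) (copy-bits a)))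
             (FinP.finToFun-funToFin {k} {2} (λ r → bits (a (mismatcher r)) r) r))
      (cong (λ s → bits s r)
        (deviate-other game a (matcher p) (copy-bits a) (≢-sym (matcher≢mismatcher p r)))))
      (agree-refl _)

  -- Mismatcher r can flip its own bit, turning its matches into mismatches.
  flip-bit : StrategyProfile → Fin k → Fin (2 ^ k)
  flip-bit a r = funToFin {k} {2} (λ _ → flip (bits (a (mismatcher r)) r))

  mismatches-flip-bit : ∀ a r →
    mismatches (deviate game a (mismatcher r) (flip-bit a r)) r ≡ columnMatches a r
  mismatches-flip-bit a r = sum-cong-≗ flipped
    where
    a′ : StrategyProfile
    a′ = deviate game a (mismatcher r) (flip-bit a r)
    flipped : ∀ p → mismatch a′ p r ≡ match a p r
    flipped p = trans (cong₂ disagree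
      (cong (λ s → bits s r)
        (deviate-other game a (mismatcher r) (flip-bit a r) (matcher≢mismatcher p r)))
      (trans (cong (λ s → bits s r) (deviate-self game a (mismatcher r) (flip-bit a r)))
             (FinP.finToFun-funToFin {k} {2} (λ _ → flip (bits (a (mismatcher r)) r)) r)))
      (cong (agree (bits (a (matcher p)) r)) (flip-involutive (bits (a (mismatcher r)) r)))

  module _ (a : StrategyProfile) (equilibrium : IsPureEquilibrium game (+ 1 ÷ 8) a) where

    -- Copying bits gains at most 1/8 = 2k/(16k): 8k ≤ 8·matches + 2k.
    matcher-bound : ∀ p → 6 * k ≤ 8 * matches a p
    matcher-bound p = ℕP.+-cancelʳ-≤ (k + k) (6 * k) (8 * matches a p)
      (subst (_≤ 8 * matches a p + (k + k)) (eight k) (÷-ε-bound {k} {matches a p} (k′ + k)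
        (subst₂ (λ x y → x ≤ℚ y +ℚ + 1 ÷ 8)
          (trans (payoff-matcher _ p) (cong share (matches-copy-bits a p)))
          (payoff-matcher a p)
          (equilibrium (matcher p) (copy-bits a)))))
      where
      eight : ∀ k → 8 * k ≡ 6 * k + (k + k)
      eight = solve-∀

    -- Flipping gains at most 1/8, and matches + mismatches = k in column r.
    mismatcher-bound : ∀ r → 6 * k ≤ 16 * mismatches a r
    mismatcher-bound r = ℕP.+-cancelʳ-≤ (k + k) (6 * k) (16 * M) (begin
      6 * k + (k + k)          ≡⟨ eight k ⟩
      8 * k                    ≡⟨ cong (8 *_) (column-total a r) ⟨
      8 * (C + M)              ≡⟨ ℕP.*-distribˡ-+ 8 C M ⟩
      8 * C + 8 * M            ≤⟨ ℕP.+-monoˡ-≤ (8 * M) flip-gain ⟩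
      8 * M + (k + k) + 8 * M  ≡⟨ regroup M (k + k) ⟩
      16 * M + (k + k)         ∎)
      where
      open ℕP.≤-Reasoning
      C M : ℕ
      C = columnMatches a r
      M = mismatches a r
      flip-gain : 8 * C ≤ 8 * M + (k + k)
      flip-gain = ÷-ε-bound {C} {M} (k′ + k)
        (subst₂ (λ x y → x ≤ℚ y +ℚ + 1 ÷ 8)
          (trans (payoff-mismatcher _ r) (cong share (mismatches-flip-bit a r)))
          (payoff-mismatcher a r)
          (equilibrium (mismatcher r) (flip-bit a r)))
      eight : ∀ k → 6 * k + (k + k) ≡ 8 * k
      eight = solve-∀
      regroup : ∀ M n → 8 * M + n + 8 * M ≡ 16 * M + n
      regroup = solve-∀

    no-equilibrium : ⊥
    no-equilibrium = k*k≢0 (no-room {k * k} {sum (columnMatches a)} {sum (mismatches a)}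
      all-matchers all-mismatchers all-cells)
      where
      open ≡-Reasoning
      six : ∀ k → k * (6 * k) ≡ 6 * (k * k)
      six = solve-∀
      -- the matches of all matchers, counted column by column
      all-matchers : 6 * (k * k) ≤ 8 * sum (columnMatches a)
      all-matchers = subst₂ _≤_ (six k) (cong (8 *_) (∑-comm (match a)))
        (sum-bound (6 * k) 8 (matches a) matcher-bound)
      all-mismatchers : 6 * (k * k) ≤ 16 * sum (mismatches a)
      all-mismatchers = subst (_≤ 16 * sum (mismatches a)) (six k)
        (sum-bound (6 * k) 16 (mismatches a) mismatcher-bound)
      all-cells : sum (columnMatches a) + sum (mismatches a) ≡ k * k
      all-cells = begin
        sum (columnMatches a) + sum (mismatches a)      ≡⟨ ∑-distrib-+ (columnMatches a) (mismatches a) ⟨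
        sum (λ r → columnMatches a r + mismatches a r)  ≡⟨ sum-cong-≗ (column-total a) ⟩
        sum {k} (λ _ → k)                               ≡⟨ sum-const k k ⟩
        k * k                                           ∎
      k*k≢0 : k * k ≢ 0
      k*k≢0 ()

  strategies : StrategiesAtMost game (2 ^ k)
  strategies _ = ℕP.m^n>0 2 k , ℕP.≤-refl

  half : (k + k) / 2 ≡ k
  half = trans (cong (_/ 2) (k+k≡k*2 k)) (m*n/n≡m k 2)

Counterexample : ℕ → Set
Counterexample n = Σ (Game n) (λ G → InL n (2 ^ (n / 2)) (recip n) G ×
  ((a : Profile G) → ¬ IsPureEquilibrium G (+ 1 ÷ 8) a))

matchingPennies-counterexample : ∀ k′ → Counterexample (suc k′ + suc k′)
matchingPennies-counterexample k′ =
  game , (strategies′ , lipschitz) , no-equilibrium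
  where
  open MatchingPennies k′
  strategies′ : StrategiesAtMost game (2 ^ ((k + k) / 2))
  strategies′ = subst (StrategiesAtMost game) (cong (2 ^_) (sym half)) strategies

proposition3 : (n : ℕ) → 2 ≤ n → 2 ∣ n →
    Σ (Game n) (λ G → InL n (2 ^ (n / 2)) (recip n) G ×
    ((a : Profile G) → ¬ IsPureEquilibrium G (+ 1 ÷ 8) a))
proposition3 .(zero * 2)   ()  (divides zero refl)
proposition3 .(suc k′ * 2) _   (divides (suc k′) refl) =
  subst Counterexample (k+k≡k*2 (suc k′)) (matchingPennies-counterexample k′)
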